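{- Let $n\in\mathbb{N}$, $w\in B_n$ and $\sigma(w)=(w_1,w_2)\in B_{m_1}\times B_{m_2}$. Then $$L(w)=a(w)+b(w)+2c(w)$$ and $$L(w)=\mathrm{neg}(w_1)+(\mathrm{inv}+\mathrm{nsp})(w)-(\mathrm{inv}+\mathrm{nsp})(w_1)-(\mathrm{inv}+\mathrm{nsp})(w_2)=\mathrm{neg}(w_1)+l(w)-l(w_1)-l(w_2).$$
   Context: For $n\in\mathbb{N}$ let $[n]=\{1,\dots,n\}$, $[\pm n]_0=\{ -n,\dots,n\}$. $B_n$ is the group of permutations $w$ of $[\pm n]_0$ with $w(-j)=-w(j)$. For $w\in B_n$: $\mathrm{inv}(w)=\#\{(i,j)\in[n]^2: i<j,\ w(i)>w(j)\}$, $\mathrm{neg}(w)=\#\{i\in[n]: w(i)<0\}$, $\mathrm{nsp}(w)=\#\{\{i,j\}\subseteq[n]: i\neq j,\ w(i)+w(j)<0\}$, $l=\mathrm{inv}+\mathrm{neg}+\mathrm{nsp}$, and $L(w)=\tfrac12\#\{(i,j)\in[\pm n]_0^2: i<j,\ w(i)>w(j),\ i\not\equiv j\pmod 2\}$. Define $a(w)=\#\{j\in[n]: j \text{ odd},\ w(j)<0\}$, $b(w)=\#\{(j,j')\in[n]^2: j<j',\ |w(j)|>|w(j')|,\ j\not\equiv j'\pmod 2\}$, $c(w)=\#\{(j,j')\in[n]^2: w(j')<0,\ j<j',\ |w(j)|<|w(j')|,\ j\not\equiv j'\pmod 2\}$. View $w$ as the signed permutation matrix whose only nonzero entry in column $j$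 is $\mathrm{sign}(w(j))$ in row $|w(j)|$. Let $m_1=\lfloor (n+1)/2\rfloor$, $m_2=\lfloor n/2\rfloor$. Then $w_1\in B_{m_1}$ is the signed permutation matrix obtained from $w$ by keeping the odd-numbered columns $1,3,5,\dots$ and the rows containing their nonzero entries (in their original order), and $w_2\in B_{m_2}$ is obtained likewise from the even-numbered columns; $\sigma(w)=(w_1,w_2)$. -}

module Defs where

open import Data.Nat as ℕ using (ℕ; zero; suc; _+_; _*_; _/_; _%_; _≡ᵇ_)
open import Data.Integer as ℤ using (ℤ; +_; -[1+_]; ∣_∣)
open import Data.Bool using (Bool; true; false; _∧_; not)
open import Data.List using (List; []; _∷_; map; length; zip; upTo; reverse; _++_; cartesianProduct; filterᵇ)
open import Data.List.Relation.Binary.Permutation.Propositional using (_↭_)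
open import Data.Product using (_×_; _,_; proj₁; proj₂)
open import Relation.Nullary.Decidable using (⌊_⌋)
open import Relation.Binary.PropositionalEquality using (_≡_)

-- A signed permutation w ∈ B_n is represented by its window
-- [w(1), ..., w(n)] as a list of integers; the values on [±n]_0 are
-- determined by w(0) = 0 and w(-j) = -w(j).
-- w ∈ B_n  iff  the list has length n and (|w(1)|,...,|w(n)|) is a
-- permutation of (1,...,n).
IsB : ℕ → List ℤ → Set
IsB n w = (length w ≡ n) × (map ∣_∣ w ↭ map suc (upTo n))

_<ℤ_ : ℤ → ℤ → Bool
x <ℤ y = ⌊ x ℤ.<? y ⌋

_<ℕ_ : ℕ → ℕ → Bool
x <ℕ y = ⌊ x ℕ.<? y ⌋

_≤ℕ_ : ℕ → ℕ → Bool
x ≤ℕ y = ⌊ x ℕ.≤? y ⌋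

isOdd : ℕ → Bool
isOdd k = (k % 2) ≡ᵇ 1

-- parity of an integer index (i ≡ j mod 2 iff |i| ≡ |j| mod 2)
diffParity : ℕ → ℕ → Bool
diffParity i j = not ((i % 2) ≡ᵇ (j % 2))

count : {A : Set} → (A → Bool) → List A → ℕ
count p xs = length (filterᵇ p xs)

idx : List ℤ → List (ℕ × ℤ)
idx w = zip (map suc (upTo (length w))) w

pairs : List ℤ → List ((ℕ × ℤ) × (ℕ × ℤ))
pairs w = cartesianProduct (idx w) (idx w)

inv : List ℤ → ℕ
inv w = count (λ { ((i , x) , (j , y)) → (i <ℕ j) ∧ (y <ℤ x) }) (pairs w)

neg : List ℤ → ℕ
neg w = count (λ { (i , x) → x <ℤ (+ 0) }) (idx w)

nsp : List ℤ → ℕ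
nsp w = count (λ { ((i , x) , (j , y)) → (i <ℕ j) ∧ ((x ℤ.+ y) <ℤ (+ 0)) }) (pairs w)

len : List ℤ → ℕ
len w = inv w + neg w + nsp w

-- full table [(i, w(i)) : i ∈ [±n]_0], indices as integers
fullTable : List ℤ → List (ℤ × ℤ)
fullTable w =
  map (λ { (i , x) → (ℤ.- (+ i) , ℤ.- x) }) (reverse (idx w))
  ++ ((+ 0 , + 0) ∷ map (λ { (i , x) → (+ i , x) }) (idx w))

Lstat : List ℤ → ℕ
Lstat w = count (λ { ((i , x) , (j , y)) → (i <ℤ j) ∧ (y <ℤ x) ∧ diffParity ∣ i ∣ ∣ j ∣ })
                (cartesianProduct (fullTable w) (fullTable w)) / 2

astat : List ℤ → ℕ
astat w = count (λ { (j , x) → isOdd j ∧ (x <ℤ (+ 0)) }) (idx w)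

bstat : List ℤ → ℕ
bstat w = count (λ { ((j , x) , (j' , y)) → (j <ℕ j') ∧ (∣ y ∣ <ℕ ∣ x ∣) ∧ diffParity j j' }) (pairs w)

cstat : List ℤ → ℕ
cstat w = count (λ { ((j , x) , (j' , y)) → (y <ℤ (+ 0)) ∧ (j <ℕ j') ∧ (∣ x ∣ <ℕ ∣ y ∣) ∧ diffParity j j' }) (pairs w)

oddCols : List ℤ → List ℤ
oddCols w = map proj₂ (filterᵇ (λ p → isOdd (proj₁ p)) (idx w))

evenCols : List ℤ → List ℤ
evenCols w = map proj₂ (filterᵇ (λ p → not (isOdd (proj₁ p))) (idx w))

-- Restrict the signed permutation matrix to the given columns and the rows
-- containing their nonzero entries (in original order): the entry with
-- value x moves to row rank(|x|) among the kept rows, keeping its sign.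
compress : List ℤ → List ℤ
compress ys = map (λ x → signed x (count (λ y → ∣ y ∣ ≤ℕ ∣ x ∣) ys)) ys
  where
  signed : ℤ → ℕ → ℤ
  signed x r with x <ℤ (+ 0)
  ... | true  = ℤ.- (+ r)
  ... | false = + r

σ₁ : List ℤ → List ℤ
σ₁ w = compress (oddCols w)

σ₂ : List ℤ → List ℤ
σ₂ w = compress (evenCols w)

module Submission where

-- Three facts then carry the proof.
--  * Sign–magnitude form: for |x| ≠ |y| (any two entries of w ∈ B_n) the tests y < x and
--    x + y < 0 depend only on the signs of x, y and on whether |y| < |x|.  Hence compressing
--    values to signed ranks (the construction of w₁, w₂) preserves inv, nsp and neg, and
--    per pair [y < x] + [x + y < 0] = [|y| < |x|] + 2[y < 0, |x| < |y|], which summed over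
--    pairs of positions of different parity ("mixed" pairs) gives b + 2c.
--  * Parity partition: equal-parity pairs are the pairs inside the odd or inside the even
--    columns, so inv = mixed inv + inv(w₁) + inv(w₂), the same for nsp, and a(w) = neg(w₁).
--  * Full table: classifying the pairs counted by L on [±n]_0 by the signs of their indices
--    gives L = a + (mixed inv) + (mixed nsp).

open import Defs
open import Data.Nat as ℕ using (ℕ; zero; suc; _+_; _*_; _≤_; _<_; z≤n; s≤s; _∸_)
import Data.Nat.Properties as ℕP
open import Algebra.Properties.CommutativeSemigroup ℕP.+-commutativeSemigroup using (interchange; x∙yz≈y∙xz)
open import Data.Nat.DivMod using (m%n<n; m*n/n≡m)
open import Data.Nat.Solver using (module +-*-Solver)
open import Data.Integer as ℤ using (ℤ; +_; -[1+_]; ∣_∣; _⊖_; _-_)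
import Data.Integer.Properties as ℤP
import Data.Integer.Solver as ℤSolver
open import Data.Bool using (Bool; true; false; _∧_; not; _xor_; T?)
open import Data.Bool.Properties using (∧-commutativeMonoid; ∧-comm; ∧-identityʳ; ∧-zeroʳ; not-involutive; xor-comm; xor-identityʳ; xor-same)
open import Algebra.Bundles using (CommutativeMonoid)
import Algebra.Properties.CommutativeSemigroup (CommutativeMonoid.commutativeSemigroup ∧-commutativeMonoid) as ∧-Props
open import Data.List using (List; []; _∷_; map; length; zip; upTo; reverse; _++_; cartesianProduct; filterᵇ)
open import Data.List.Properties using (unfold-reverse; length-map; length-upTo; map-cong)
open import Data.List.Membership.Propositional using (_∈_)
open import Data.List.Relation.Unary.Any using (here; there)
open import Data.List.Relation.Unary.All as All using (All; []; _∷_)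
open import Data.List.Relation.Unary.AllPairs using (AllPairs; []; _∷_)
import Data.List.Relation.Unary.AllPairs.Properties as AllPairsP
import Data.List.Relation.Unary.Unique.Propositional.Properties as UniqueP
open import Data.List.Relation.Binary.Permutation.Propositional using (↭-sym; ↭⇒↭ₛ)
import Data.List.Relation.Binary.Permutation.Setoid.Properties as PermutationP
open import Data.Product using (_×_; _,_; proj₁; proj₂)
open import Data.Empty using (⊥-elim)
open import Function using (_∘_)
open import Relation.Nullary using (Dec; yes; no; ¬_)
open import Relation.Nullary.Decidable using (⌊_⌋; isYes≗does; dec-true; dec-false)
open import Relation.Binary using (tri<; tri≈; tri>)
open import Relation.Binary.PropositionalEquality

ind : Bool → ℕ
ind true  = 1
ind false = 0

∑ : {A : Set} → (A → ℕ) → List A → ℕ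
∑ f []       = 0
∑ f (x ∷ xs) = f x + ∑ f xs

module _ {A : Set} where

  count≡∑ : ∀ (p : A → Bool) xs → count p xs ≡ ∑ (ind ∘ p) xs
  count≡∑ p [] = refl
  count≡∑ p (x ∷ xs) with p x
  ... | true  = cong suc (count≡∑ p xs)
  ... | false = count≡∑ p xs

  ∑-cong : ∀ {f g : A → ℕ} → (∀ a → f a ≡ g a) → ∀ xs → ∑ f xs ≡ ∑ g xs
  ∑-cong f≡g []       = refl
  ∑-cong f≡g (x ∷ xs) = cong₂ _+_ (f≡g x) (∑-cong f≡g xs)

  ∑-congᴬ : ∀ {f g : A → ℕ} {xs} → All (λ a → f a ≡ g a) xs → ∑ f xs ≡ ∑ g xs
  ∑-congᴬ []         = refl
  ∑-congᴬ (e ∷ es) = cong₂ _+_ e (∑-congᴬ es)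

  ∑-zero : ∀ xs → ∑ (λ (_ : A) → 0) xs ≡ 0
  ∑-zero []       = refl
  ∑-zero (x ∷ xs) = ∑-zero xs

  ∑-+ : ∀ (f g : A → ℕ) xs → ∑ (λ a → f a + g a) xs ≡ ∑ f xs + ∑ g xs
  ∑-+ f g []       = refl
  ∑-+ f g (x ∷ xs) rewrite ∑-+ f g xs = interchange (f x) (g x) (∑ f xs) (∑ g xs)

  ∑-* : ∀ k (f : A → ℕ) xs → ∑ (λ a → k * f a) xs ≡ k * ∑ f xs
  ∑-* k f []       = sym (ℕP.*-zeroʳ k)
  ∑-* k f (x ∷ xs) rewrite ∑-* k f xs = sym (ℕP.*-distribˡ-+ k (f x) (∑ f xs))

  ∑-++ : ∀ (f : A → ℕ) xs ys → ∑ f (xs ++ ys) ≡ ∑ f xs + ∑ f ys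
  ∑-++ f []       ys = refl
  ∑-++ f (x ∷ xs) ys rewrite ∑-++ f xs ys = sym (ℕP.+-assoc (f x) _ _)

  ∑-reverse : ∀ (f : A → ℕ) xs → ∑ f (reverse xs) ≡ ∑ f xs
  ∑-reverse f []       = refl
  ∑-reverse f (x ∷ xs) rewrite unfold-reverse x xs | ∑-++ f (reverse xs) (x ∷ []) | ∑-reverse f xs
    = trans (ℕP.+-comm (∑ f xs) (f x + 0)) (cong (_+ ∑ f xs) (ℕP.+-identityʳ (f x)))

  ∑-filter : ∀ (p q : A → Bool) xs → ∑ (λ a → ind (p a ∧ q a)) xs ≡ ∑ (ind ∘ q) (filterᵇ p xs)
  ∑-filter p q [] = refl
  ∑-filter p q (x ∷ xs) with p x
  ... | true  = cong (_+_ (ind (q x))) (∑-filter p q xs)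
  ... | false = ∑-filter p q xs

  ∑-partition : ∀ (f : A → ℕ) (p : A → Bool) xs → ∑ f xs ≡ ∑ f (filterᵇ p xs) + ∑ f (filterᵇ (not ∘ p) xs)
  ∑-partition f p [] = refl
  ∑-partition f p (x ∷ xs) with p x
  ... | true  rewrite ∑-partition f p xs = sym (ℕP.+-assoc (f x) _ _)
  ... | false rewrite ∑-partition f p xs = x∙yz≈y∙xz (f x) (∑ f (filterᵇ p xs)) (∑ f (filterᵇ (not ∘ p) xs))

  ∑-mono : ∀ {f g : A → ℕ} → (∀ a → f a ≤ g a) → ∀ xs → ∑ f xs ≤ ∑ g xs
  ∑-mono f≤g []       = z≤n
  ∑-mono f≤g (x ∷ xs) = ℕP.+-mono-≤ (f≤g x) (∑-mono f≤g xs)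

  ∑-mono-< : ∀ {f g : A → ℕ} → (∀ a → f a ≤ g a) → ∀ {z xs} → z ∈ xs → f z < g z → ∑ f xs < ∑ g xs
  ∑-mono-< f≤g {xs = x ∷ xs} (here refl) lt = ℕP.+-mono-<-≤ lt (∑-mono f≤g xs)
  ∑-mono-< f≤g {xs = x ∷ xs} (there z∈) lt = ℕP.+-mono-≤-< (f≤g x) (∑-mono-< f≤g z∈ lt)

∑-map : ∀ {A B : Set} (f : B → ℕ) (g : A → B) xs → ∑ f (map g xs) ≡ ∑ (f ∘ g) xs
∑-map f g []       = refl
∑-map f g (x ∷ xs) = cong (_+_ (f (g x))) (∑-map f g xs)

module _ {A B : Set} where

  ∑-comm : ∀ (f : A → B → ℕ) xs ys → ∑ (λ a → ∑ (f a) ys) xs ≡ ∑ (λ b → ∑ (λ a → f a b) xs) ys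
  ∑-comm f []       ys = sym (∑-zero ys)
  ∑-comm f (x ∷ xs) ys = trans (cong (_+_ (∑ (f x) ys)) (∑-comm f xs ys))
                               (sym (∑-+ (f x) (λ b → ∑ (λ a → f a b) xs) ys))

  ∑-cartesian : ∀ (F : A × B → ℕ) xs ys → ∑ F (cartesianProduct xs ys) ≡ ∑ (λ a → ∑ (λ b → F (a , b)) ys) xs
  ∑-cartesian F []       ys = refl
  ∑-cartesian F (x ∷ xs) ys = trans (∑-++ F (map (x ,_) ys) _) (cong₂ _+_ (∑-map F (x ,_) ys) (∑-cartesian F xs ys))

∑pairs : {A : Set} → (A → A → ℕ) → List A → ℕ
∑pairs g []       = 0
∑pairs g (x ∷ xs) = ∑ (g x) xs + ∑pairs g xs

module _ {A : Set} where

  ∑pairs-cong : ∀ {g h : A → A → ℕ} → (∀ a b → g a b ≡ h a b) → ∀ xs → ∑pairs g xs ≡ ∑pairs h xs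
  ∑pairs-cong g≡h []       = refl
  ∑pairs-cong g≡h (x ∷ xs) = cong₂ _+_ (∑-cong (g≡h x) xs) (∑pairs-cong g≡h xs)

  ∑pairs-cong∈ : ∀ {R : A → A → Set} {g h : A → A → ℕ} {xs} → AllPairs R xs →
                 (∀ {a b} → a ∈ xs → b ∈ xs → R a b → g a b ≡ h a b) → ∑pairs g xs ≡ ∑pairs h xs
  ∑pairs-cong∈ [] g≡h = refl
  ∑pairs-cong∈ (r ∷ rs) g≡h =
    cong₂ _+_ (∑-congᴬ (All.tabulate (λ b∈ → g≡h (here refl) (there b∈) (All.lookup r b∈))))
              (∑pairs-cong∈ rs (λ a∈ b∈ → g≡h (there a∈) (there b∈)))

  ∑pairs-+ : ∀ (g h : A → A → ℕ) xs → ∑pairs (λ a b → g a b + h a b) xs ≡ ∑pairs g xs + ∑pairs h xs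
  ∑pairs-+ g h []       = refl
  ∑pairs-+ g h (x ∷ xs) rewrite ∑-+ (g x) (h x) xs | ∑pairs-+ g h xs =
    interchange (∑ (g x) xs) (∑ (h x) xs) (∑pairs g xs) (∑pairs h xs)

  ∑pairs-* : ∀ k (g : A → A → ℕ) xs → ∑pairs (λ a b → k * g a b) xs ≡ k * ∑pairs g xs
  ∑pairs-* k g []       = sym (ℕP.*-zeroʳ k)
  ∑pairs-* k g (x ∷ xs) rewrite ∑-* k (g x) xs | ∑pairs-* k g xs = sym (ℕP.*-distribˡ-+ k _ _)

∑pairs-map : ∀ {A B : Set} (g : B → B → ℕ) (f : A → B) xs → ∑pairs g (map f xs) ≡ ∑pairs (λ a b → g (f a) (f b)) xs
∑pairs-map g f []       = refl
∑pairs-map g f (x ∷ xs) = cong₂ _+_ (∑-map (g (f x)) f xs) (∑pairs-map g f xs)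

⌊⌋-true : ∀ {P : Set} (p : Dec P) → P → ⌊ p ⌋ ≡ true
⌊⌋-true p x = trans (isYes≗does p) (dec-true p x)

⌊⌋-false : ∀ {P : Set} (p : Dec P) → ¬ P → ⌊ p ⌋ ≡ false
⌊⌋-false p ¬x = trans (isYes≗does p) (dec-false p ¬x)

⌊⌋-⇔ : ∀ {P Q : Set} (p : Dec P) (q : Dec Q) → (P → Q) → (Q → P) → ⌊ p ⌋ ≡ ⌊ q ⌋
⌊⌋-⇔ (yes x) q to from = sym (⌊⌋-true q (to x))
⌊⌋-⇔ (no ¬x) q to from = sym (⌊⌋-false q (¬x ∘ from))

<ℕ-true : ∀ {i j} → i < j → (i <ℕ j) ≡ true
<ℕ-true {i} {j} = ⌊⌋-true (i ℕ.<? j)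

<ℕ-false : ∀ {i j} → ¬ i < j → (i <ℕ j) ≡ false
<ℕ-false {i} {j} = ⌊⌋-false (i ℕ.<? j)

<ℕ-irrefl : ∀ i → (i <ℕ i) ≡ false
<ℕ-irrefl i = <ℕ-false (ℕP.<-irrefl refl)

<ℕ-flip : ∀ {i j} → i ≢ j → (i <ℕ j) ≡ not (j <ℕ i)
<ℕ-flip {i} {j} i≢j with ℕP.<-cmp i j
... | tri< i<j _ j≮i = trans (<ℕ-true i<j) (cong not (sym (<ℕ-false j≮i)))
... | tri≈ _ i≡j _   = ⊥-elim (i≢j i≡j)
... | tri> i≮j _ j<i = trans (<ℕ-false i≮j) (cong not (sym (<ℕ-true j<i)))

∑∑-increasing : ∀ {A : Set} (key : A → ℕ) (G : A → A → Bool) xs → AllPairs (λ a b → key a < key b) xs →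
  ∑ (λ a → ∑ (λ b → ind ((key a <ℕ key b) ∧ G a b)) xs) xs ≡ ∑pairs (λ a b → ind (G a b)) xs
∑∑-increasing key G [] _ = refl
∑∑-increasing {A} key G (a ∷ xs) (a<xs ∷ sorted) = begin
  (F a a + ∑ (F a) xs) + ∑ (λ c → F c a + ∑ (F c) xs) xs
    ≡⟨ cong₂ _+_ (cong (_+ ∑ (F a) xs) diagonal) (∑-+ (λ c → F c a) (λ c → ∑ (F c) xs) xs) ⟩
  ∑ (F a) xs + (∑ (λ c → F c a) xs + ∑ (λ c → ∑ (F c) xs) xs)
    ≡⟨ cong₂ (λ t u → t + (u + ∑ (λ c → ∑ (F c) xs) xs)) row column ⟩
  ∑ (λ b → ind (G a b)) xs + ∑ (λ c → ∑ (F c) xs) xs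
    ≡⟨ cong (_+_ (∑ (λ b → ind (G a b)) xs)) (∑∑-increasing key G xs sorted) ⟩
  ∑ (λ b → ind (G a b)) xs + ∑pairs (λ a b → ind (G a b)) xs ∎
  where
  open ≡-Reasoning
  F : A → A → ℕ
  F u v = ind ((key u <ℕ key v) ∧ G u v)
  diagonal : F a a ≡ 0
  diagonal rewrite <ℕ-irrefl (key a) = refl
  row : ∑ (F a) xs ≡ ∑ (λ b → ind (G a b)) xs
  row = ∑-congᴬ (All.map (λ {b} a<b → cong (λ t → ind (t ∧ G a b)) (<ℕ-true a<b)) a<xs)
  column : ∑ (λ c → F c a) xs ≡ 0
  column = trans (∑-congᴬ (All.map (λ {c} a<c → cong (λ t → ind (t ∧ G c a)) (<ℕ-false (ℕP.<-asym a<c))) a<xs))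
                 (∑-zero xs)

xor-bits : ∀ {r s} → r < 2 → s < 2 → not (r ℕ.≡ᵇ s) ≡ (r ℕ.≡ᵇ 1) xor (s ℕ.≡ᵇ 1)
xor-bits {0} {0} _ _ = refl
xor-bits {0} {1} _ _ = refl
xor-bits {1} {0} _ _ = refl
xor-bits {1} {1} _ _ = refl
xor-bits {suc (suc _)} (s≤s (s≤s ())) _
xor-bits {0} {suc (suc _)} _ (s≤s (s≤s ()))
xor-bits {1} {suc (suc _)} _ (s≤s (s≤s ()))

diffParity-xor : ∀ i j → diffParity i j ≡ isOdd i xor isOdd j
diffParity-xor i j = xor-bits (m%n<n i 2) (m%n<n j 2)

diffParity-sym : ∀ i j → diffParity i j ≡ diffParity j i
diffParity-sym i j rewrite diffParity-xor i j | diffParity-xor j i = xor-comm (isOdd i) (isOdd j)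

diffParity-refl : ∀ i → diffParity i i ≡ false
diffParity-refl i = trans (diffParity-xor i i) (xor-same (isOdd i))

diffParity-zero : ∀ i → diffParity i 0 ≡ isOdd i
diffParity-zero i = trans (diffParity-xor i 0) (xor-identityʳ (isOdd i))

sameParity-odd : ∀ {i} j → isOdd i ≡ true → not (diffParity i j) ≡ isOdd j
sameParity-odd {i} j odd rewrite diffParity-xor i j | odd = not-involutive (isOdd j)

sameParity-even : ∀ {i} j → isOdd i ≡ false → not (diffParity i j) ≡ not (isOdd j)
sameParity-even {i} j even rewrite diffParity-xor i j | even = refl

-- For integers x, y with |x| ≠ |y| put
-- s = [x < 0], t = [y < 0] and q = [|y| < |x|]; then [y < x] = greaterBySigns s t q
-- and [x + y < 0] = negSumBySigns s t q.
greaterBySigns : Bool → Bool → Bool → Bool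
greaterBySigns false false q = q
greaterBySigns true  true  q = not q
greaterBySigns false true  q = true
greaterBySigns true  false q = false

negSumBySigns : Bool → Bool → Bool → Bool
negSumBySigns false false q = false
negSumBySigns true  true  q = true
negSumBySigns false true  q = not q
negSumBySigns true  false q = q

⊖-negative : ∀ a b → ((a ⊖ b) <ℤ (+ 0)) ≡ (a <ℕ b)
⊖-negative a b = ⌊⌋-⇔ ((a ⊖ b) ℤ.<? + 0) (a ℕ.<? b) to from
  where
  to : (a ⊖ b) ℤ.< + 0 → a < b
  to lt with a ℕ.<? b
  ... | yes a<b = a<b
  ... | no a≮b with subst (ℤ._< + 0) (ℤP.⊖-≥ (ℕP.≮⇒≥ a≮b)) lt
  ... | ℤ.+<+ ()
  from : a < b → (a ⊖ b) ℤ.< + 0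
  from a<b rewrite ℤP.⊖-< a<b with b ∸ a | ℕP.m<n⇒0<n∸m a<b
  ... | suc _ | _ = ℤ.-<+

+<+-≡ : ∀ i j → ((+ i) <ℤ (+ j)) ≡ (i <ℕ j)
+<+-≡ i j = ⌊⌋-⇔ (+ i ℤ.<? + j) (i ℕ.<? j) ℤP.drop‿+<+ ℤ.+<+

greater-bySigns : ∀ x y → ∣ x ∣ ≢ ∣ y ∣ → (y <ℤ x) ≡ greaterBySigns (x <ℤ (+ 0)) (y <ℤ (+ 0)) (∣ y ∣ <ℕ ∣ x ∣)
greater-bySigns (+ m) (+ k) _ = +<+-≡ k m
greater-bySigns (+ m) -[1+ k ] _ = refl
greater-bySigns -[1+ m ] (+ k) _ = ⌊⌋-false (+ k ℤ.<? -[1+ m ]) (λ ())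
greater-bySigns -[1+ m ] -[1+ k ] ≢ =
  trans (⌊⌋-⇔ (-[1+ k ] ℤ.<? -[1+ m ]) (m ℕ.<? k) (λ { (ℤ.-<- m<k) → m<k }) ℤ.-<-)
        (trans (<ℕ-flip (≢ ∘ cong suc)) (cong not (⌊⌋-⇔ (k ℕ.<? m) (suc k ℕ.<? suc m) s≤s ℕP.≤-pred)))

negSum-bySigns : ∀ x y → ∣ x ∣ ≢ ∣ y ∣ → ((x ℤ.+ y) <ℤ (+ 0)) ≡ negSumBySigns (x <ℤ (+ 0)) (y <ℤ (+ 0)) (∣ y ∣ <ℕ ∣ x ∣)
negSum-bySigns (+ m) (+ k) _ = refl
negSum-bySigns (+ m) -[1+ k ] ≢ = trans (⊖-negative m (suc k)) (<ℕ-flip ≢)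
negSum-bySigns -[1+ m ] (+ k) _ = ⊖-negative k (suc m)
negSum-bySigns -[1+ m ] -[1+ k ] _ = refl

-- The per-pair identity behind b + 2c:
-- [y < x] + [x + y < 0] = [|y| < |x|] + 2·[y < 0 and |x| < |y|].
inv+nsp-bySigns : ∀ s t q → ind (greaterBySigns s t q) + ind (negSumBySigns s t q) ≡ ind q + 2 * ind (t ∧ not q)
inv+nsp-bySigns false false false = refl
inv+nsp-bySigns false false true  = refl
inv+nsp-bySigns false true  false = refl
inv+nsp-bySigns false true  true  = refl
inv+nsp-bySigns true  false false = refl
inv+nsp-bySigns true  false true  = refl
inv+nsp-bySigns true  true  false = refl
inv+nsp-bySigns true  true  true  = refl

inv+nsp-bySigns-guarded : ∀ s t q d →
  ind (greaterBySigns s t q ∧ d) + ind (negSumBySigns s t q ∧ d) ≡ ind (q ∧ d) + 2 * ind (t ∧ not q ∧ d)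
inv+nsp-bySigns-guarded s t q true
  rewrite ∧-identityʳ (greaterBySigns s t q) | ∧-identityʳ (negSumBySigns s t q)
        | ∧-identityʳ q | ∧-identityʳ (not q) = inv+nsp-bySigns s t q
inv+nsp-bySigns-guarded s t q false
  rewrite ∧-zeroʳ (greaterBySigns s t q) | ∧-zeroʳ (negSumBySigns s t q)
        | ∧-zeroʳ q | ∧-zeroʳ (not q) | ∧-zeroʳ t = refl

inversion : ℤ → ℤ → Bool
inversion x y = y <ℤ x

negativeSum : ℤ → ℤ → Bool
negativeSum x y = (x ℤ.+ y) <ℤ (+ 0)

isNegative : ℤ → Bool
isNegative x = x <ℤ (+ 0)

Item : Set
Item = ℕ × ℤ

onValues : (ℤ → ℤ → Bool) → Item → Item → Bool
onValues c a b = c (proj₂ a) (proj₂ b)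

unzip-zip : ∀ {A B : Set} (xs : List A) (ys : List B) → length xs ≡ length ys →
  (map proj₁ (zip xs ys) ≡ xs) × (map proj₂ (zip xs ys) ≡ ys)
unzip-zip []       []       _ = refl , refl
unzip-zip []       (y ∷ ys) ()
unzip-zip (x ∷ xs) []       ()
unzip-zip (x ∷ xs) (y ∷ ys) e with unzip-zip xs ys (ℕP.suc-injective e)
... | p₁ , p₂ = cong (x ∷_) p₁ , cong (y ∷_) p₂

idx-unzip : ∀ w → (map proj₁ (idx w) ≡ map suc (upTo (length w))) × (map proj₂ (idx w) ≡ w)
idx-unzip w = unzip-zip (map suc (upTo (length w))) w
                        (trans (length-map suc (upTo (length w))) (length-upTo (length w)))

idx-increasing : ∀ w → AllPairs (λ a b → proj₁ a < proj₁ b) (idx w)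
idx-increasing w = AllPairsP.map⁻ (subst (AllPairs _<_) (sym (proj₁ (idx-unzip w))) increasing)
  where
  increasing : AllPairs _<_ (map suc (upTo (length w)))
  increasing = AllPairsP.map⁺ (AllPairsP.applyUpTo⁺₁ (λ i → i) (length w) (λ i<j _ → s≤s i<j))

idx-AllPairs : ∀ {R : ℤ → ℤ → Set} {w} → AllPairs R w → AllPairs (λ a b → R (proj₂ a) (proj₂ b)) (idx w)
idx-AllPairs {R} {w} r = AllPairsP.map⁻ (subst (AllPairs R) (sym (proj₂ (idx-unzip w))) r)

∑-values : ∀ (f : ℤ → ℕ) w → ∑ (f ∘ proj₂) (idx w) ≡ ∑ f w
∑-values f w = trans (sym (∑-map f proj₂ (idx w))) (cong (∑ f) (proj₂ (idx-unzip w)))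

∑pairs-values : ∀ (c : ℤ → ℤ → Bool) w → ∑pairs (λ a b → ind (onValues c a b)) (idx w) ≡ ∑pairs (λ x y → ind (c x y)) w
∑pairs-values c w = trans (sym (∑pairs-map (λ x y → ind (c x y)) proj₂ (idx w)))
                          (cong (∑pairs (λ x y → ind (c x y))) (proj₂ (idx-unzip w)))

count-pairs : ∀ (P : Item × Item → Bool) (G : Item → Item → Bool) w →
  (∀ a b → P (a , b) ≡ ((proj₁ a <ℕ proj₁ b) ∧ G a b)) →
  count P (pairs w) ≡ ∑pairs (λ a b → ind (G a b)) (idx w)
count-pairs P G w P≡ = begin
  count P (pairs w)                                 ≡⟨ count≡∑ P (pairs w) ⟩
  ∑ (ind ∘ P) (cartesianProduct (idx w) (idx w))    ≡⟨ ∑-cartesian (ind ∘ P) (idx w) (idx w) ⟩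
  ∑ (λ a → ∑ (λ b → ind (P (a , b))) (idx w)) (idx w)
    ≡⟨ ∑-cong (λ a → ∑-cong (λ b → cong ind (P≡ a b)) (idx w)) (idx w) ⟩
  ∑ (λ a → ∑ (λ b → ind ((proj₁ a <ℕ proj₁ b) ∧ G a b)) (idx w)) (idx w)
    ≡⟨ ∑∑-increasing proj₁ G (idx w) (idx-increasing w) ⟩
  ∑pairs (λ a b → ind (G a b)) (idx w) ∎
  where open ≡-Reasoning

inv-∑pairs : ∀ w → inv w ≡ ∑pairs (λ x y → ind (inversion x y)) w
inv-∑pairs w = trans (count-pairs _ (onValues inversion) w (λ a b → refl)) (∑pairs-values inversion w)

nsp-∑pairs : ∀ w → nsp w ≡ ∑pairs (λ x y → ind (negativeSum x y)) w
nsp-∑pairs w = trans (count-pairs _ (onValues negativeSum) w (λ a b → refl)) (∑pairs-values negativeSum w)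

neg-∑ : ∀ w → neg w ≡ ∑ (ind ∘ isNegative) w
neg-∑ w = trans (count≡∑ _ (idx w)) (∑-values (ind ∘ isNegative) w)

DistinctAbs : ℤ → ℤ → Set
DistinctAbs x y = ∣ x ∣ ≢ ∣ y ∣

IsB⇒distinctAbs : ∀ n w → IsB n w → AllPairs DistinctAbs w
IsB⇒distinctAbs n w (_ , perm) =
  AllPairsP.map⁻ (PermutationP.Unique-resp-↭ (setoid ℕ) (↭⇒↭ₛ (↭-sym perm))
                   (UniqueP.map⁺ ℕP.suc-injective (UniqueP.upTo⁺ n)))

record Similar (x y x′ y′ : ℤ) : Set where
  field
    distinct  : DistinctAbs x y
    distinct′ : DistinctAbs x′ y′
    sign-x    : isNegative x′ ≡ isNegative x
    sign-y    : isNegative y′ ≡ isNegative y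
    order     : (∣ y′ ∣ <ℕ ∣ x′ ∣) ≡ (∣ y ∣ <ℕ ∣ x ∣)

-- By the sign–magnitude form, both pair tests are invariant under similarity.
inversion-invariant : ∀ {x y x′ y′} → Similar x y x′ y′ → inversion x′ y′ ≡ inversion x y
inversion-invariant {x} {y} {x′} {y′} sim
  rewrite greater-bySigns x′ y′ (Similar.distinct′ sim) | Similar.sign-x sim | Similar.sign-y sim | Similar.order sim
  = sym (greater-bySigns x y (Similar.distinct sim))

negativeSum-invariant : ∀ {x y x′ y′} → Similar x y x′ y′ → negativeSum x′ y′ ≡ negativeSum x y
negativeSum-invariant {x} {y} {x′} {y′} sim
  rewrite negSum-bySigns x′ y′ (Similar.distinct′ sim) | Similar.sign-x sim | Similar.sign-y sim | Similar.order sim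
  = sym (negSum-bySigns x y (Similar.distinct sim))

rank : List ℤ → ℤ → ℕ
rank ys x = count (λ y → ∣ y ∣ ≤ℕ ∣ x ∣) ys

withSign : Bool → ℕ → ℤ
withSign true  r = ℤ.- (+ r)
withSign false r = + r

compressEntry : List ℤ → ℤ → ℤ
compressEntry ys x = withSign (isNegative x) (rank ys x)

compress-map : ∀ ys → compress ys ≡ map (compressEntry ys) ys
compress-map ys = map-cong (λ { (+ _) → refl ; -[1+ _ ] → refl }) ys

withSign-negative : ∀ s {r} → 1 ≤ r → isNegative (withSign s r) ≡ s
withSign-negative true  {suc _} _ = refl
withSign-negative false {suc _} _ = refl

∣withSign∣ : ∀ s r → ∣ withSign s r ∣ ≡ r
∣withSign∣ true  zero    = refl
∣withSign∣ true  (suc r) = refl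
∣withSign∣ false r       = refl

rank-mono : ∀ {ys x y} → y ∈ ys → ∣ x ∣ < ∣ y ∣ → rank ys x < rank ys y
rank-mono {ys} {x} {y} y∈ys x<y
  rewrite count≡∑ (λ z → ∣ z ∣ ≤ℕ ∣ x ∣) ys | count≡∑ (λ z → ∣ z ∣ ≤ℕ ∣ y ∣) ys = ∑-mono-< pointwise y∈ys strict
  where
  pointwise : ∀ z → ind (∣ z ∣ ≤ℕ ∣ x ∣) ≤ ind (∣ z ∣ ≤ℕ ∣ y ∣)
  pointwise z with ∣ z ∣ ℕ.≤? ∣ x ∣
  ... | no _ = z≤n
  ... | yes z≤x rewrite ⌊⌋-true (∣ z ∣ ℕ.≤? ∣ y ∣) (ℕP.≤-trans z≤x (ℕP.<⇒≤ x<y)) = s≤s z≤n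
  strict : ind (∣ y ∣ ≤ℕ ∣ x ∣) < ind (∣ y ∣ ≤ℕ ∣ y ∣)
  strict rewrite ⌊⌋-false (∣ y ∣ ℕ.≤? ∣ x ∣) (ℕP.<⇒≱ x<y) | ⌊⌋-true (∣ y ∣ ℕ.≤? ∣ y ∣) ℕP.≤-refl = s≤s z≤n

rank-positive : ∀ {ys x} → x ∈ ys → 1 ≤ rank ys x
rank-positive {ys} {x} x∈ys rewrite count≡∑ (λ z → ∣ z ∣ ≤ℕ ∣ x ∣) ys =
  subst (_< ∑ (λ z → ind (∣ z ∣ ≤ℕ ∣ x ∣)) ys) (∑-zero ys) (∑-mono-< (λ _ → z≤n) x∈ys self)
  where
  self : 0 < ind (∣ x ∣ ≤ℕ ∣ x ∣)
  self rewrite ⌊⌋-true (∣ x ∣ ℕ.≤? ∣ x ∣) ℕP.≤-refl = s≤s z≤n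

module _ {ys : List ℤ} {x y : ℤ} (x∈ys : x ∈ ys) (y∈ys : y ∈ ys) (x≢y : DistinctAbs x y) where

  rank-distinct : rank ys x ≢ rank ys y
  rank-distinct r≡ with ℕP.<-cmp ∣ x ∣ ∣ y ∣
  ... | tri< x<y _ _ = ℕP.<-irrefl r≡ (rank-mono {ys} {x} y∈ys x<y)
  ... | tri≈ _ x≡y _ = x≢y x≡y
  ... | tri> _ _ y<x = ℕP.<-irrefl (sym r≡) (rank-mono {ys} {y} x∈ys y<x)

  rank-order : (rank ys y <ℕ rank ys x) ≡ (∣ y ∣ <ℕ ∣ x ∣)
  rank-order = ⌊⌋-⇔ (rank ys y ℕ.<? rank ys x) (∣ y ∣ ℕ.<? ∣ x ∣) to (rank-mono {ys} {y} x∈ys)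
    where
    to : rank ys y < rank ys x → ∣ y ∣ < ∣ x ∣
    to r< with ℕP.<-cmp ∣ x ∣ ∣ y ∣
    ... | tri< x<y _ _ = ⊥-elim (ℕP.<-asym r< (rank-mono {ys} {x} y∈ys x<y))
    ... | tri≈ _ x≡y _ = ⊥-elim (x≢y x≡y)
    ... | tri> _ _ y<x = y<x

  compress-similar : Similar x y (compressEntry ys x) (compressEntry ys y)
  compress-similar = record
    { distinct  = x≢y
    ; distinct′ = λ e → rank-distinct (trans (sym (∣withSign∣ (isNegative x) _)) (trans e (∣withSign∣ (isNegative y) _)))
    ; sign-x    = withSign-negative (isNegative x) (rank-positive x∈ys)
    ; sign-y    = withSign-negative (isNegative y) (rank-positive y∈ys)
    ; order     = trans (cong₂ _<ℕ_ (∣withSign∣ (isNegative y) _) (∣withSign∣ (isNegative x) _)) rank-order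
    }

∑pairs-compress : ∀ (c : ℤ → ℤ → Bool) → (∀ {x y x′ y′} → Similar x y x′ y′ → c x′ y′ ≡ c x y) →
  ∀ ys → AllPairs DistinctAbs ys → ∑pairs (λ x y → ind (c x y)) (compress ys) ≡ ∑pairs (λ x y → ind (c x y)) ys
∑pairs-compress c invariant ys distinct = begin
  ∑pairs (λ x y → ind (c x y)) (compress ys)                      ≡⟨ cong (∑pairs _) (compress-map ys) ⟩
  ∑pairs (λ x y → ind (c x y)) (map (compressEntry ys) ys)        ≡⟨ ∑pairs-map _ (compressEntry ys) ys ⟩
  ∑pairs (λ x y → ind (c (compressEntry ys x) (compressEntry ys y))) ys
    ≡⟨ ∑pairs-cong∈ distinct (λ x∈ y∈ x≢y → cong ind (invariant (compress-similar x∈ y∈ x≢y))) ⟩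
  ∑pairs (λ x y → ind (c x y)) ys ∎
  where open ≡-Reasoning

neg-compress : ∀ ys → neg (compress ys) ≡ neg ys
neg-compress ys = begin
  neg (compress ys)                                 ≡⟨ neg-∑ (compress ys) ⟩
  ∑ (ind ∘ isNegative) (compress ys)                ≡⟨ cong (∑ (ind ∘ isNegative)) (compress-map ys) ⟩
  ∑ (ind ∘ isNegative) (map (compressEntry ys) ys)  ≡⟨ ∑-map (ind ∘ isNegative) (compressEntry ys) ys ⟩
  ∑ (ind ∘ isNegative ∘ compressEntry ys) ys
    ≡⟨ ∑-congᴬ {xs = ys} (All.tabulate (λ {x} x∈ → cong ind (withSign-negative (isNegative x) (rank-positive {ys} x∈)))) ⟩
  ∑ (ind ∘ isNegative) ys                          ≡⟨ sym (neg-∑ ys) ⟩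
  neg ys ∎
  where open ≡-Reasoning

oddPos : Item → Bool
oddPos a = isOdd (proj₁ a)

mixed : Item → Item → Bool
mixed a b = diffParity (proj₁ a) (proj₁ b)

mixedPairs : (ℤ → ℤ → Bool) → List ℤ → ℕ
mixedPairs c w = ∑pairs (λ a b → ind (onValues c a b ∧ mixed a b)) (idx w)

mixedTotal : List ℤ → ℕ
mixedTotal w = mixedPairs inversion w + mixedPairs negativeSum w

column : (Item → Bool) → List ℤ → List ℤ
column p w = map proj₂ (filterᵇ p (idx w))

ind-split : ∀ c d → ind c ≡ ind (c ∧ d) + ind (c ∧ not d)
ind-split true  true  = refl
ind-split true  false = refl
ind-split false d     = refl

sameParity-row : ∀ (c : Item → Item → Bool) a (p : Item → Bool) I → (∀ b → not (mixed a b) ≡ p b) →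
  ∑ (λ b → ind (c a b ∧ not (mixed a b))) I ≡ ∑ (λ b → ind (c a b)) (filterᵇ p I)
sameParity-row c a p I same =
  trans (∑-cong (λ b → cong ind (trans (cong (c a b ∧_) (same b)) (∧-comm (c a b) (p b)))) I) (∑-filter p (c a) I)

∑pairs-sameParity : ∀ (c : Item → Item → Bool) I →
  ∑pairs (λ a b → ind (c a b ∧ not (mixed a b))) I
    ≡ ∑pairs (λ a b → ind (c a b)) (filterᵇ oddPos I) + ∑pairs (λ a b → ind (c a b)) (filterᵇ (not ∘ oddPos) I)
∑pairs-sameParity c [] = refl
∑pairs-sameParity c (a ∷ I) with oddPos a in parity
... | true  = trans (cong₂ _+_ (sameParity-row c a oddPos I (λ b → sameParity-odd {proj₁ a} (proj₁ b) parity))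
                               (∑pairs-sameParity c I))
                    (sym (ℕP.+-assoc (∑ (λ b → ind (c a b)) (filterᵇ oddPos I)) _ _))
... | false = trans (cong₂ _+_ (sameParity-row c a (not ∘ oddPos) I (λ b → sameParity-even {proj₁ a} (proj₁ b) parity))
                               (∑pairs-sameParity c I))
                    (x∙yz≈y∙xz (∑ (λ b → ind (c a b)) (filterᵇ (not ∘ oddPos) I))
                                (∑pairs (λ a b → ind (c a b)) (filterᵇ oddPos I))
                                (∑pairs (λ a b → ind (c a b)) (filterᵇ (not ∘ oddPos) I)))

column-distinct : ∀ p w → AllPairs DistinctAbs w → AllPairs DistinctAbs (column p w)
column-distinct p w d = AllPairsP.map⁺ (AllPairsP.filter⁺ (T? ∘ p) (idx-AllPairs d))

pairStat-split : ∀ (c : ℤ → ℤ → Bool) → (∀ {x y x′ y′} → Similar x y x′ y′ → c x′ y′ ≡ c x y) →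
  ∀ w → AllPairs DistinctAbs w →
  ∑pairs (λ x y → ind (c x y)) w ≡ mixedPairs c w + ∑pairs (λ x y → ind (c x y)) (σ₁ w) + ∑pairs (λ x y → ind (c x y)) (σ₂ w)
pairStat-split c invariant w d = begin
  ∑pairs C w                                          ≡⟨ sym (∑pairs-values c w) ⟩
  ∑pairs (λ a b → ind (onValues c a b)) (idx w)
    ≡⟨ ∑pairs-cong (λ a b → ind-split (onValues c a b) (mixed a b)) (idx w) ⟩
  ∑pairs (λ a b → ind (onValues c a b ∧ mixed a b) + ind (onValues c a b ∧ not (mixed a b))) (idx w)
    ≡⟨ ∑pairs-+ _ _ (idx w) ⟩
  mixedPairs c w + ∑pairs (λ a b → ind (onValues c a b ∧ not (mixed a b))) (idx w)
    ≡⟨ cong (_+_ (mixedPairs c w)) (∑pairs-sameParity (onValues c) (idx w)) ⟩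
  mixedPairs c w + (columnSum oddPos + columnSum (not ∘ oddPos))
    ≡⟨ cong (_+_ (mixedPairs c w)) (cong₂ _+_ (compressed oddPos) (compressed (not ∘ oddPos))) ⟩
  mixedPairs c w + (∑pairs C (σ₁ w) + ∑pairs C (σ₂ w)) ≡⟨ sym (ℕP.+-assoc (mixedPairs c w) _ _) ⟩
  mixedPairs c w + ∑pairs C (σ₁ w) + ∑pairs C (σ₂ w) ∎
  where
  open ≡-Reasoning
  C : ℤ → ℤ → ℕ
  C x y = ind (c x y)
  columnSum : (Item → Bool) → ℕ
  columnSum p = ∑pairs (λ a b → ind (onValues c a b)) (filterᵇ p (idx w))
  compressed : ∀ p → columnSum p ≡ ∑pairs C (compress (column p w))
  compressed p = trans (sym (∑pairs-map C proj₂ (filterᵇ p (idx w))))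
                       (sym (∑pairs-compress c invariant (column p w) (column-distinct p w d)))

inv-split : ∀ w → AllPairs DistinctAbs w → inv w ≡ mixedPairs inversion w + inv (σ₁ w) + inv (σ₂ w)
inv-split w d = begin
  inv w                  ≡⟨ inv-∑pairs w ⟩
  ∑pairs _ w             ≡⟨ pairStat-split inversion inversion-invariant w d ⟩
  mixedPairs inversion w + ∑pairs _ (σ₁ w) + ∑pairs _ (σ₂ w)
    ≡⟨ sym (cong₂ (λ s t → mixedPairs inversion w + s + t) (inv-∑pairs (σ₁ w)) (inv-∑pairs (σ₂ w))) ⟩
  mixedPairs inversion w + inv (σ₁ w) + inv (σ₂ w) ∎
  where open ≡-Reasoning

nsp-split : ∀ w → AllPairs DistinctAbs w → nsp w ≡ mixedPairs negativeSum w + nsp (σ₁ w) + nsp (σ₂ w)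
nsp-split w d = begin
  nsp w                  ≡⟨ nsp-∑pairs w ⟩
  ∑pairs _ w             ≡⟨ pairStat-split negativeSum negativeSum-invariant w d ⟩
  mixedPairs negativeSum w + ∑pairs _ (σ₁ w) + ∑pairs _ (σ₂ w)
    ≡⟨ sym (cong₂ (λ s t → mixedPairs negativeSum w + s + t) (nsp-∑pairs (σ₁ w)) (nsp-∑pairs (σ₂ w))) ⟩
  mixedPairs negativeSum w + nsp (σ₁ w) + nsp (σ₂ w) ∎
  where open ≡-Reasoning

column-neg : ∀ p w → ∑ (ind ∘ isNegative ∘ proj₂) (filterᵇ p (idx w)) ≡ neg (compress (column p w))
column-neg p w = begin
  ∑ (ind ∘ isNegative ∘ proj₂) (filterᵇ p (idx w)) ≡⟨ sym (∑-map (ind ∘ isNegative) proj₂ (filterᵇ p (idx w))) ⟩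
  ∑ (ind ∘ isNegative) (column p w)                ≡⟨ sym (neg-∑ (column p w)) ⟩
  neg (column p w)                                 ≡⟨ sym (neg-compress (column p w)) ⟩
  neg (compress (column p w)) ∎
  where open ≡-Reasoning

neg-split : ∀ w → neg w ≡ neg (σ₁ w) + neg (σ₂ w)
neg-split w = trans (count≡∑ _ (idx w))
  (trans (∑-partition (ind ∘ isNegative ∘ proj₂) oddPos (idx w))
         (cong₂ _+_ (column-neg oddPos w) (column-neg (not ∘ oddPos) w)))

astat≡neg-σ₁ : ∀ w → astat w ≡ neg (σ₁ w)
astat≡neg-σ₁ w = trans (count≡∑ _ (idx w))
  (trans (∑-filter oddPos (isNegative ∘ proj₂) (idx w)) (column-neg oddPos w))

∑∑-symmetric : ∀ {A : Set} (key : A → ℕ) (G : A → A → Bool) → (∀ a b → G a b ≡ G b a) →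
  (∀ a b → key a ≡ key b → G a b ≡ false) → ∀ xs →
  ∑ (λ a → ∑ (λ b → ind (G a b)) xs) xs ≡ 2 * ∑ (λ a → ∑ (λ b → ind ((key a <ℕ key b) ∧ G a b)) xs) xs
∑∑-symmetric {A} key G symmetric sameKey xs = begin
  ∑ (λ a → ∑ (λ b → ind (G a b)) xs) xs
    ≡⟨ ∑-cong (λ a → trans (∑-cong (bothOrders a) xs) (∑-+ (F a) (λ b → F b a) xs)) xs ⟩
  ∑ (λ a → ∑ (F a) xs + ∑ (λ b → F b a) xs) xs
    ≡⟨ ∑-+ (λ a → ∑ (F a) xs) (λ a → ∑ (λ b → F b a) xs) xs ⟩
  X + ∑ (λ a → ∑ (λ b → F b a) xs) xs  ≡⟨ cong (_+_ X) (∑-comm (λ a b → F b a) xs xs) ⟩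
  X + X                                ≡⟨ cong (_+_ X) (sym (ℕP.+-identityʳ X)) ⟩
  2 * X ∎
  where
  open ≡-Reasoning
  F : A → A → ℕ
  F u v = ind ((key u <ℕ key v) ∧ G u v)
  X : ℕ
  X = ∑ (λ a → ∑ (F a) xs) xs
  bothOrders : ∀ a b → ind (G a b) ≡ F a b + F b a
  bothOrders a b with ℕP.<-cmp (key a) (key b)
  ... | tri< a<b _ b≮a rewrite <ℕ-true a<b | <ℕ-false b≮a = sym (ℕP.+-identityʳ _)
  ... | tri≈ _ a≡b _ rewrite sameKey a b a≡b | sameKey b a (sym a≡b)
                           | ∧-zeroʳ (key a <ℕ key b) | ∧-zeroʳ (key b <ℕ key a) = refl
  ... | tri> a≮b _ b<a rewrite <ℕ-false a≮b | <ℕ-true b<a = cong ind (symmetric a b)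

magnitudeInversion : Item → Item → Bool
magnitudeInversion a b = (∣ proj₂ b ∣ <ℕ ∣ proj₂ a ∣) ∧ mixed a b

negativeAbove : Item → Item → Bool
negativeAbove a b = isNegative (proj₂ b) ∧ (∣ proj₂ a ∣ <ℕ ∣ proj₂ b ∣) ∧ mixed a b

bstat-∑pairs : ∀ w → bstat w ≡ ∑pairs (λ a b → ind (magnitudeInversion a b)) (idx w)
bstat-∑pairs w = count-pairs _ magnitudeInversion w (λ a b → refl)

cstat-∑pairs : ∀ w → cstat w ≡ ∑pairs (λ a b → ind (negativeAbove a b)) (idx w)
cstat-∑pairs w = count-pairs _ negativeAbove w
  (λ a b → ∧-Props.x∙yz≈y∙xz (isNegative (proj₂ b)) (proj₁ a <ℕ proj₁ b) _)

mixedPairs≡b+2c : ∀ w → AllPairs DistinctAbs w → mixedTotal w ≡ bstat w + 2 * cstat w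
mixedPairs≡b+2c w distinct = begin
  mixedPairs inversion w + mixedPairs negativeSum w ≡⟨ sym (∑pairs-+ _ _ (idx w)) ⟩
  ∑pairs (λ a b → ind (onValues inversion a b ∧ mixed a b) + ind (onValues negativeSum a b ∧ mixed a b)) (idx w)
    ≡⟨ ∑pairs-cong∈ (idx-AllPairs distinct) (λ {a} {b} _ _ → perPair a b) ⟩
  ∑pairs (λ a b → ind (magnitudeInversion a b) + 2 * ind (negativeAbove a b)) (idx w) ≡⟨ ∑pairs-+ _ _ (idx w) ⟩
  ∑pairs (λ a b → ind (magnitudeInversion a b)) (idx w) + ∑pairs (λ a b → 2 * ind (negativeAbove a b)) (idx w)
    ≡⟨ cong₂ _+_ (sym (bstat-∑pairs w)) (trans (∑pairs-* 2 _ (idx w)) (cong (2 *_) (sym (cstat-∑pairs w)))) ⟩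
  bstat w + 2 * cstat w ∎
  where
  open ≡-Reasoning
  perPair : ∀ a b → DistinctAbs (proj₂ a) (proj₂ b) →
    ind (onValues inversion a b ∧ mixed a b) + ind (onValues negativeSum a b ∧ mixed a b)
      ≡ ind (magnitudeInversion a b) + 2 * ind (negativeAbove a b)
  perPair (i , x) (j , y) x≢y rewrite greater-bySigns x y x≢y | negSum-bySigns x y x≢y | <ℕ-flip {∣ x ∣} {∣ y ∣} x≢y =
    inv+nsp-bySigns-guarded (isNegative x) (isNegative y) (∣ y ∣ <ℕ ∣ x ∣) (diffParity i j)

negate-<ℤ : ∀ x y → ((ℤ.- y) <ℤ (ℤ.- x)) ≡ (x <ℤ y)
negate-<ℤ x y = ⌊⌋-⇔ (ℤ.- y ℤ.<? ℤ.- x) (x ℤ.<? y) ℤP.neg-cancel-< ℤP.neg-mono-<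

<-negate⇔negativeSum : ∀ x y → (y <ℤ (ℤ.- x)) ≡ negativeSum x y
<-negate⇔negativeSum x y = ⌊⌋-⇔ (y ℤ.<? ℤ.- x) ((x ℤ.+ y) ℤ.<? + 0) to from
  where
  to : y ℤ.< ℤ.- x → (x ℤ.+ y) ℤ.< + 0
  to y<-x = subst ((x ℤ.+ y) ℤ.<_) (ℤP.+-inverseʳ x) (ℤP.+-monoʳ-< x y<-x)
  from : (x ℤ.+ y) ℤ.< + 0 → y ℤ.< ℤ.- x
  from x+y<0 = subst₂ ℤ._<_ cancel (ℤP.+-identityʳ (ℤ.- x)) (ℤP.+-monoʳ-< (ℤ.- x) x+y<0)
    where
    cancel : ℤ.- x ℤ.+ (x ℤ.+ y) ≡ y
    cancel = trans (sym (ℤP.+-assoc (ℤ.- x) x y)) (trans (cong (ℤ._+ y) (ℤP.+-inverseˡ x)) (ℤP.+-identityˡ y))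

lift : Item → ℤ × ℤ
lift a = (+ proj₁ a , proj₂ a)

mirror : Item → ℤ × ℤ
mirror a = (ℤ.- (+ proj₁ a) , ℤ.- (proj₂ a))

origin : ℤ × ℤ
origin = (+ 0 , + 0)

∑-fullTable : ∀ (h : ℤ × ℤ → ℕ) w → ∑ h (fullTable w) ≡ ∑ (h ∘ mirror) (idx w) + (h origin + ∑ (h ∘ lift) (idx w))
∑-fullTable h w = trans (∑-++ h (map mirror (reverse (idx w))) _)
  (cong₂ _+_ (trans (∑-map h mirror (reverse (idx w))) (∑-reverse (h ∘ mirror) (idx w)))
             (cong (_+_ (h origin)) (∑-map h lift (idx w))))

Ltest : (ℤ × ℤ) × (ℤ × ℤ) → Bool
Ltest (p , q) = (proj₁ p <ℤ proj₁ q) ∧ (proj₂ q <ℤ proj₂ p) ∧ diffParity ∣ proj₁ p ∣ ∣ proj₁ q ∣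

risingInversion : Item → Item → Bool
risingInversion a b = (proj₁ a <ℕ proj₁ b) ∧ onValues inversion a b ∧ mixed a b

mixedNegativeSum : Item → Item → Bool
mixedNegativeSum a b = onValues negativeSum a b ∧ mixed a b

oddNegative : Item → Bool
oddNegative a = oddPos a ∧ isNegative (proj₂ a)

Ltest-mirror-mirror : ∀ a b → Ltest (mirror a , mirror b) ≡ risingInversion b a
Ltest-mirror-mirror (i , x) (j , y)
  rewrite negate-<ℤ (+ j) (+ i) | negate-<ℤ x y | ℤP.∣-i∣≡∣i∣ (+ i) | ℤP.∣-i∣≡∣i∣ (+ j)
        | +<+-≡ j i | diffParity-sym i j = refl

Ltest-mirror-origin : ∀ a → Ltest (mirror a , origin) ≡ oddNegative a
Ltest-mirror-origin (zero , x) = refl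
Ltest-mirror-origin (suc i , x) rewrite negate-<ℤ x (+ 0) | diffParity-zero (suc i) = ∧-comm (isNegative x) (isOdd (suc i))

Ltest-mirror-lift : ∀ a b → Ltest (mirror a , lift b) ≡ mixedNegativeSum a b
Ltest-mirror-lift (zero , x) (zero , y) = sym (∧-zeroʳ (negativeSum x y))
Ltest-mirror-lift (zero , x) (suc j , y) rewrite <-negate⇔negativeSum x y = refl
Ltest-mirror-lift (suc i , x) (j , y) rewrite <-negate⇔negativeSum x y = refl

Ltest-origin-mirror : ∀ b → Ltest (origin , mirror b) ≡ false
Ltest-origin-mirror (zero , y)  = refl
Ltest-origin-mirror (suc j , y) = refl

Ltest-origin-lift : ∀ b → Ltest (origin , lift b) ≡ oddNegative b
Ltest-origin-lift (zero , y)  = refl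
Ltest-origin-lift (suc j , y) rewrite diffParity-sym 0 (suc j) | diffParity-zero (suc j) =
  ∧-comm (isNegative y) (isOdd (suc j))

Ltest-lift-mirror : ∀ a b → Ltest (lift a , mirror b) ≡ false
Ltest-lift-mirror (i , x) (zero , y)  = refl
Ltest-lift-mirror (i , x) (suc j , y) = refl

Ltest-lift-lift : ∀ a b → Ltest (lift a , lift b) ≡ risingInversion a b
Ltest-lift-lift (i , x) (j , y) rewrite +<+-≡ i j = refl

module FullTableRows (w : List ℤ) where

  I : List Item
  I = idx w

  rowSum : ℤ × ℤ → ℕ
  rowSum p = ∑ (λ q → ind (Ltest (p , q))) (fullTable w)

  mirrorRow : ∀ a → rowSum (mirror a) ≡
    ∑ (λ b → ind (risingInversion b a)) I + (ind (oddNegative a) + ∑ (λ b → ind (mixedNegativeSum a b)) I)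
  mirrorRow a = trans (∑-fullTable (λ q → ind (Ltest (mirror a , q))) w)
    (cong₂ _+_ (∑-cong (cong ind ∘ Ltest-mirror-mirror a) I)
               (cong₂ _+_ (cong ind (Ltest-mirror-origin a)) (∑-cong (cong ind ∘ Ltest-mirror-lift a) I)))

  originRow : rowSum origin ≡ ∑ (ind ∘ oddNegative) I
  originRow = trans (∑-fullTable (λ q → ind (Ltest (origin , q))) w)
    (cong₂ _+_ (trans (∑-cong (cong ind ∘ Ltest-origin-mirror) I) (∑-zero I))
               (∑-cong (cong ind ∘ Ltest-origin-lift) I))

  liftRow : ∀ a → rowSum (lift a) ≡ ∑ (λ b → ind (risingInversion a b)) I
  liftRow a = trans (∑-fullTable (λ q → ind (Ltest (lift a , q))) w)
    (cong₂ _+_ (trans (∑-cong (cong ind ∘ Ltest-lift-mirror a) I) (∑-zero I))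
               (∑-cong (cong ind ∘ Ltest-lift-lift a) I))

  negativeSums-twice : ∑ (λ a → ∑ (λ b → ind (mixedNegativeSum a b)) I) I
    ≡ 2 * ∑ (λ a → ∑ (λ b → ind ((proj₁ a <ℕ proj₁ b) ∧ mixedNegativeSum a b)) I) I
  negativeSums-twice = ∑∑-symmetric proj₁ mixedNegativeSum
    (λ a b → cong₂ _∧_ (cong (_<ℤ (+ 0)) (ℤP.+-comm (proj₂ a) (proj₂ b))) (diffParity-sym (proj₁ a) (proj₁ b)))
    (λ a b i≡j → trans (cong (λ j → onValues negativeSum a b ∧ diffParity (proj₁ a) j) (sym i≡j))
                       (trans (cong (onValues negativeSum a b ∧_) (diffParity-refl (proj₁ a))) (∧-zeroʳ _)))
    I

-- L(w) = a(w) + (mixed inversions) + (mixed negative-sum pairs): each pair counted by L on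
-- [±n]_0 is, up to the symmetry (i, j) ↦ (−j, −i), a mixed inversion among positive indices,
-- a pair (−i, 0) with i odd and w(i) < 0, or a pair (−i, j) with w(i) + w(j) < 0.
Lstat≡a+mixed : ∀ w → Lstat w ≡ astat w + mixedTotal w
Lstat≡a+mixed w = begin
  Lstat w                                                       ≡⟨ cong (ℕ._/ 2) doubleCount ⟩
  (A + (R + N)) * 2 ℕ./ 2                                       ≡⟨ m*n/n≡m (A + (R + N)) 2 ⟩
  A + (R + N)
    ≡⟨ cong₂ _+_ (sym (count≡∑ _ I))
         (cong₂ _+_ (∑∑-increasing proj₁ (λ a b → onValues inversion a b ∧ mixed a b) I (idx-increasing w))
                    (∑∑-increasing proj₁ mixedNegativeSum I (idx-increasing w))) ⟩
  astat w + mixedTotal w ∎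
  where
  open ≡-Reasoning
  open FullTableRows w
  A R N : ℕ
  A = ∑ (ind ∘ oddNegative) I
  R = ∑ (λ a → ∑ (λ b → ind (risingInversion a b)) I) I
  N = ∑ (λ a → ∑ (λ b → ind ((proj₁ a <ℕ proj₁ b) ∧ mixedNegativeSum a b)) I) I
  doubleCount : count Ltest (cartesianProduct (fullTable w) (fullTable w)) ≡ (A + (R + N)) * 2
  doubleCount = begin
    count Ltest (cartesianProduct (fullTable w) (fullTable w))
      ≡⟨ trans (count≡∑ Ltest (cartesianProduct (fullTable w) (fullTable w))) (∑-cartesian (ind ∘ Ltest) (fullTable w) (fullTable w)) ⟩
    ∑ rowSum (fullTable w)                                     ≡⟨ ∑-fullTable rowSum w ⟩
    ∑ (rowSum ∘ mirror) I + (rowSum origin + ∑ (rowSum ∘ lift) I)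
      ≡⟨ cong₂ _+_ (∑-cong mirrorRow I) (cong₂ _+_ originRow (∑-cong liftRow I)) ⟩
    ∑ (λ a → ∑ (λ b → ind (risingInversion b a)) I + (ind (oddNegative a) + ∑ (λ b → ind (mixedNegativeSum a b)) I)) I + (A + R)
      ≡⟨ cong (_+ (A + R)) (trans (∑-+ _ _ I) (cong₂ _+_ (∑-comm (λ a b → ind (risingInversion b a)) I I)
                                                           (∑-+ (ind ∘ oddNegative) _ I))) ⟩
    (R + (A + ∑ (λ a → ∑ (λ b → ind (mixedNegativeSum a b)) I) I)) + (A + R)
      ≡⟨ cong (λ t → (R + (A + t)) + (A + R)) negativeSums-twice ⟩
    (R + (A + 2 * N)) + (A + R)                                 ≡⟨ rearrange R A N ⟩
    (A + (R + N)) * 2 ∎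
    where
    open +-*-Solver
    rearrange : ∀ r a n → (r + (a + 2 * n)) + (a + r) ≡ (a + (r + n)) * 2
    rearrange = solve 3 (λ r a n → (r :+ (a :+ con 2 :* n)) :+ (a :+ r) := (a :+ (r :+ n)) :* con 2) refl

inv+nsp-split : ∀ w → AllPairs DistinctAbs w →
  inv w + nsp w ≡ mixedTotal w + (inv (σ₁ w) + nsp (σ₁ w)) + (inv (σ₂ w) + nsp (σ₂ w))
inv+nsp-split w d rewrite inv-split w d | nsp-split w d =
  regroup (mixedPairs inversion w) (mixedPairs negativeSum w) (inv (σ₁ w)) (inv (σ₂ w)) (nsp (σ₁ w)) (nsp (σ₂ w))
  where
  open +-*-Solver
  regroup : ∀ p q i₁ i₂ n₁ n₂ → (p + i₁ + i₂) + (q + n₁ + n₂) ≡ (p + q) + (i₁ + n₁) + (i₂ + n₂)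
  regroup = solve 6 (λ p q i₁ i₂ n₁ n₂ → (p :+ i₁ :+ i₂) :+ (q :+ n₁ :+ n₂) := (p :+ q) :+ (i₁ :+ n₁) :+ (i₂ :+ n₂)) refl

len-split : ∀ w → AllPairs DistinctAbs w → len w ≡ mixedTotal w + len (σ₁ w) + len (σ₂ w)
len-split w d rewrite inv-split w d | nsp-split w d | neg-split w =
  regroup (mixedPairs inversion w) (mixedPairs negativeSum w) (inv (σ₁ w)) (inv (σ₂ w))
          (neg (σ₁ w)) (neg (σ₂ w)) (nsp (σ₁ w)) (nsp (σ₂ w))
  where
  open +-*-Solver
  regroup : ∀ p q i₁ i₂ g₁ g₂ n₁ n₂ →
    (p + i₁ + i₂) + (g₁ + g₂) + (q + n₁ + n₂) ≡ (p + q) + (i₁ + g₁ + n₁) + (i₂ + g₂ + n₂)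
  regroup = solve 8 (λ p q i₁ i₂ g₁ g₂ n₁ n₂ →
    (p :+ i₁ :+ i₂) :+ (g₁ :+ g₂) :+ (q :+ n₁ :+ n₂) := (p :+ q) :+ (i₁ :+ g₁ :+ n₁) :+ (i₂ :+ g₂ :+ n₂)) refl

cancel-columns : ∀ a m e f → + (a + m) ≡ (+ a) ℤ.+ (+ (m + e + f)) - (+ e) - (+ f)
cancel-columns a m e f rewrite ℤP.pos-+ a m | ℤP.pos-+ (m + e) f | ℤP.pos-+ m e =
  solve 4 (λ a m e f → a :+ m := a :+ (m :+ e :+ f) :- e :- f) refl (+ a) (+ m) (+ e) (+ f)
  where open ℤSolver.+-*-Solver

lemma2p4 : (n : ℕ) (w : List ℤ) → IsB n w →
    (Lstat w ≡ astat w + bstat w + 2 * cstat w)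
    × ((+ Lstat w) ≡ (+ neg (σ₁ w)) ℤ.+ (+ (inv w + nsp w)) - (+ (inv (σ₁ w) + nsp (σ₁ w))) - (+ (inv (σ₂ w) + nsp (σ₂ w))))
    × ((+ Lstat w) ≡ (+ neg (σ₁ w)) ℤ.+ (+ len w) - (+ len (σ₁ w)) - (+ len (σ₂ w)))
lemma2p4 n w isB = L≡a+b+2c , L≡via-inv+nsp , L≡via-len
  where
  distinct : AllPairs DistinctAbs w
  distinct = IsB⇒distinctAbs n w isB

  L≡a+b+2c : Lstat w ≡ astat w + bstat w + 2 * cstat w
  L≡a+b+2c = trans (Lstat≡a+mixed w)
    (trans (cong (_+_ (astat w)) (mixedPairs≡b+2c w distinct)) (sym (ℕP.+-assoc (astat w) _ _)))

  L≡neg₁+mixed : + Lstat w ≡ + (neg (σ₁ w) + mixedTotal w)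
  L≡neg₁+mixed = cong +_ (trans (Lstat≡a+mixed w) (cong (_+ mixedTotal w) (astat≡neg-σ₁ w)))

  L≡via-inv+nsp : (+ Lstat w) ≡ (+ neg (σ₁ w)) ℤ.+ (+ (inv w + nsp w)) - (+ (inv (σ₁ w) + nsp (σ₁ w))) - (+ (inv (σ₂ w) + nsp (σ₂ w)))
  L≡via-inv+nsp = trans L≡neg₁+mixed
    (trans (cancel-columns (neg (σ₁ w)) (mixedTotal w) (inv (σ₁ w) + nsp (σ₁ w)) (inv (σ₂ w) + nsp (σ₂ w)))
           (cong (λ t → (+ neg (σ₁ w)) ℤ.+ (+ t) - (+ (inv (σ₁ w) + nsp (σ₁ w))) - (+ (inv (σ₂ w) + nsp (σ₂ w))))
                 (sym (inv+nsp-split w distinct))))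

  L≡via-len : (+ Lstat w) ≡ (+ neg (σ₁ w)) ℤ.+ (+ len w) - (+ len (σ₁ w)) - (+ len (σ₂ w))
  L≡via-len = trans L≡neg₁+mixed
    (trans (cancel-columns (neg (σ₁ w)) (mixedTotal w) (len (σ₁ w)) (len (σ₂ w)))
           (cong (λ t → (+ neg (σ₁ w)) ℤ.+ (+ t) - (+ len (σ₁ w)) - (+ len (σ₂ w))) (sym (len-split w distinct))))
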